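{- For all $q_1,q_2\in\mathbb{N}$ with $\gcd(q_1,q_2)=1$ and all $a_1,a_2\in\mathbb{N}$, $$h(q_1q_2,\,a_1q_2+a_2q_1)=h(q_1,\,a_1q_2)\,h(q_2,\,a_2q_1).$$
   Context: Fix $s\in\mathbb{N}$, $\alpha_1,\dots,\alpha_s\in\mathbb{N}_0$ and $r_1,\dots,r_s\in\mathbb{N}$ with $2\le r_1\le\dots\le r_s$. For $a,q,d_1,\dots,d_s\in\mathbb{N}$ let $\mathcal{E}_a(d_1,\dots,d_s,q)=1$ if the system $n\equiv-\alpha_j\pmod{d_j}$ ($1\le j\le s$), $n\equiv a\pmod q$ has a solution $n$, and $0$ otherwise. For a prime $p$ and $a,q\in\mathbb{N}$ set $$\chi_a^{(q)}(p)=\sum_{\delta_1,\dots,\delta_s\in\{0,1\}}(-1)^{\delta_1+\dots+\delta_s}\frac{\gcd(L_\delta,q)}{L_\delta}\,\mathcal{E}_a(p^{\delta_1r_1},\dots,p^{\delta_sr_s},q),\quad L_\delta=\operatorname{lcm}(p^{\delta_1r_1},\dots,p^{\delta_sr_s}),$$ and $h(q,a)=\prod_{p\mid q}\chi_a^{(q)}(p)$ (product over primes dividing $q$). -}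

module Defs where

open import Data.Nat using (ℕ; zero; suc; _+_; _*_; _^_; ∣_-_∣)
open import Data.Nat.Divisibility using (_∣_; _∣?_)
open import Data.Nat.GCD using (gcd)
open import Data.Nat.LCM using (lcm)
open import Data.Nat.Primality using (Prime; prime?)
open import Data.Bool using (Bool; true; false; if_then_else_)
open import Data.Fin using (Fin; toℕ)
import Data.Fin as Fin
open import Data.Fin.Properties using (any?; all?)
open import Data.List using (List; upTo; filter; foldr)
open import Data.Integer using (+_)
open import Data.Rational using (ℚ; _/_; 0ℚ; 1ℚ; -_) renaming (_+_ to _+ℚ_; _*_ to _*ℚ_)
open import Data.Product using (_×_)
open import Relation.Nullary using (Dec; yes; no; does)
open import Relation.Nullary.Decidable using (_×-dec_)

-- m / n as a rational, with the (never used) convention m / 0 = 0.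
frac : ℕ → ℕ → ℚ
frac m zero = 0ℚ
frac m (suc n) = (+ m) / suc n

prodF : (s : ℕ) → (Fin s → ℕ) → ℕ
prodF zero f = 1
prodF (suc s) f = f Fin.zero * prodF s (λ i → f (Fin.suc i))

lcmF : (s : ℕ) → (Fin s → ℕ) → ℕ
lcmF zero f = 1
lcmF (suc s) f = lcm (f Fin.zero) (lcmF s (λ i → f (Fin.suc i)))

sumδ : (s : ℕ) → ((Fin s → Bool) → ℚ) → ℚ
sumδ zero F = F (λ ())
sumδ (suc s) F =
  sumδ s (λ δ → F (λ { Fin.zero → false ; (Fin.suc i) → δ i }))
  +ℚ sumδ s (λ δ → F (λ { Fin.zero → true ; (Fin.suc i) → δ i }))

signδ : (s : ℕ) → (Fin s → Bool) → ℚ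
signδ zero δ = 1ℚ
signδ (suc s) δ =
  (if δ Fin.zero then -_ else (λ x → x)) (signδ s (λ i → δ (Fin.suc i)))

-- The system  n ≡ -α_j (mod d_j) (1 ≤ j ≤ s),  n ≡ a (mod q),  for a given n.
-- (n ≡ -α (mod d) is  d ∣ n + α;  n ≡ a (mod q) is  q ∣ |n - a|.)
Solves : (s : ℕ) → (Fin s → ℕ) → (Fin s → ℕ) → ℕ → ℕ → ℕ → Set
Solves s α d a q n = (∀ j → d j ∣ n + α j) × (q ∣ ∣ n - a ∣)

solves? : (s : ℕ) (α d : Fin s → ℕ) (a q n : ℕ) → Dec (Solves s α d a q n)
solves? s α d a q n = all? (λ j → d j ∣? n + α j) ×-dec (q ∣? ∣ n - a ∣)

-- 𝓔_a(d_1,…,d_s,q): 1 if the system has a solution n, else 0.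
-- The system is periodic mod lcm(d_1,…,d_s,q), which divides
-- M = q * d_1 * … * d_s (all moduli are positive in every use below),
-- so a solution exists iff one exists with n < M; we search that range.
𝓔 : (s : ℕ) → (Fin s → ℕ) → ℕ → (Fin s → ℕ) → ℕ → ℚ
𝓔 s α a d q with any? {n = q * prodF s d} (λ (n : Fin (q * prodF s d)) → solves? s α d a q (toℕ n))
... | yes _ = 1ℚ
... | no _ = 0ℚ

χ : (s : ℕ) → (α r : Fin s → ℕ) → (a q p : ℕ) → ℚ
χ s α r a q p = sumδ s (λ δ →
  let d : Fin s → ℕ
      d j = if δ j then p ^ r j else 1
      L = lcmF s d
  in signδ s δ *ℚ (frac (gcd L q) L *ℚ 𝓔 s α a d q))

primeDivisors : ℕ → List ℕ
primeDivisors q = filter (λ p → prime? p ×-dec (p ∣? q)) (upTo (suc q))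

h : (s : ℕ) → (α r : Fin s → ℕ) → (q a : ℕ) → ℚ
h s α r q a = foldr (λ p acc → χ s α r a q p *ℚ acc) 1ℚ (primeDivisors q)

-- For p ∣ q₁
-- every modulus p^{δⱼrⱼ} in the sum defining the local factor is coprime to q₂, so
-- gcd(L, q₁q₂) = gcd(L, q₁), and by the Chinese remainder theorem the system with
-- n ≡ a₁q₂ + a₂q₁ (mod q₁q₂) is solvable iff the one with n ≡ a₁q₂ (mod q₁) is.
-- Hence each local factor of h(q₁q₂, ·) at p ∣ q₁ (resp. p ∣ q₂) is the matching local
-- factor of h(q₁, ·) (resp. h(q₂, ·)), and the primes dividing q₁q₂ split between q₁ and q₂.
module Submission where

open import Defs
open import Algebra.Bundles using (CommutativeMonoid)
open import Data.Bool using (Bool; true; false; if_then_else_)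
open import Data.Empty using (⊥-elim)
open import Data.Fin using (Fin; toℕ; fromℕ<)
import Data.Fin as Fin
open import Data.Fin.Properties using (any?; toℕ-fromℕ<)
open import Data.List using (List; []; _∷_; [_]; _++_; filter; foldr; upTo)
open import Data.List.Properties using (filter-++; filter-reject; ++-identityʳ; upTo-∷ʳ)
open import Data.Nat
open import Data.Nat.Properties
open import Data.Nat.DivMod
open import Data.Nat.Divisibility
open import Data.Nat.Coprimality using (Coprime; coprime-divisor; coprime-Bézout; gcd≡1⇒coprime) renaming (sym to coprime-sym)
open import Data.Nat.GCD using (gcd; gcd[m,n]∣m; gcd[m,n]∣n; gcd-greatest; module Bézout)
open import Data.Nat.LCM using (lcm; lcm-least)
open import Data.Nat.Primality using (Prime; prime?; prime⇒nonZero; ¬prime[1]; euclidsLemma)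
open import Data.Nat.Tactic.RingSolver using (solve-∀)
open import Data.Product using (∃; ∃-syntax; _×_; _,_; proj₁; proj₂)
open import Data.Rational using (ℚ; 0ℚ; 1ℚ) renaming (_+_ to _+ℚ_; _*_ to _*ℚ_)
import Data.Rational.Properties as ℚ
open import Data.Sum using (inj₁; inj₂; [_,_]′)
open import Function using (_∘_)
open import Function.Bundles using (_⇔_; mk⇔; Equivalence)
open import Level using (0ℓ)
open import Relation.Nullary using (¬_; Dec; yes; no; does)
open import Relation.Nullary.Decidable using (_×-dec_; map′)
open import Relation.Unary using (Pred; Decidable)
open import Relation.Binary.PropositionalEquality hiding ([_])
open ≡-Reasoning
open import Algebra.Properties.CommutativeSemigroup
  (CommutativeMonoid.commutativeSemigroup ℚ.*-1-commutativeMonoid) using (interchange)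

%-+-cong : ∀ {m m′ n n′ q} .{{_ : NonZero q}} →
           m % q ≡ m′ % q → n % q ≡ n′ % q → (m + n) % q ≡ (m′ + n′) % q
%-+-cong {m} {m′} {n} {n′} {q} eq₁ eq₂ = begin
  (m + n) % q            ≡⟨ %-distribˡ-+ m n q ⟩
  (m % q + n % q) % q    ≡⟨ cong₂ (λ x y → (x + y) % q) eq₁ eq₂ ⟩
  (m′ % q + n′ % q) % q  ≡⟨ %-distribˡ-+ m′ n′ q ⟨
  (m′ + n′) % q          ∎

%-*-cong : ∀ {m m′ n n′ q} .{{_ : NonZero q}} →
           m % q ≡ m′ % q → n % q ≡ n′ % q → (m * n) % q ≡ (m′ * n′) % q
%-*-cong {m} {m′} {n} {n′} {q} eq₁ eq₂ = begin
  (m * n) % q              ≡⟨ %-distribˡ-* m n q ⟩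
  (m % q * (n % q)) % q    ≡⟨ cong₂ (λ x y → (x * y) % q) eq₁ eq₂ ⟩
  (m′ % q * (n′ % q)) % q  ≡⟨ %-distribˡ-* m′ n′ q ⟨
  (m′ * n′) % q            ∎

%≡-∣ : ∀ {m n d q} .{{_ : NonZero d}} .{{_ : NonZero q}} →
       d ∣ q → m % q ≡ n % q → m % d ≡ n % d
%≡-∣ {m} {n} {d} {q} d∣q eq = begin
  m % d      ≡⟨ m∣n⇒o%n%m≡o%m d q m d∣q ⟨
  m % q % d  ≡⟨ cong (_% d) eq ⟩
  n % q % d  ≡⟨ m∣n⇒o%n%m≡o%m d q n d∣q ⟩
  n % d      ∎

%≡⇒∣∸ : ∀ {m n q} .{{_ : NonZero q}} → m % q ≡ n % q → q ∣ n ∸ m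
%≡⇒∣∸ {m} {n} {q} eq = divides (n / q ∸ m / q) (begin
  n ∸ m                                      ≡⟨ cong₂ _∸_ (m≡m%n+[m/n]*n n q) (m≡m%n+[m/n]*n m q) ⟩
  (n % q + n / q * q) ∸ (m % q + m / q * q)  ≡⟨ cong (λ x → (n % q + n / q * q) ∸ (x + m / q * q)) eq ⟩
  (n % q + n / q * q) ∸ (n % q + m / q * q)  ≡⟨ [m+n]∸[m+o]≡n∸o (n % q) _ _ ⟩
  n / q * q ∸ m / q * q                      ≡⟨ *-distribʳ-∸ q (n / q) (m / q) ⟨
  (n / q ∸ m / q) * q                        ∎)

∣∸⇒%≡ : ∀ {m n q} .{{_ : NonZero q}} → m ≤ n → q ∣ n ∸ m → m % q ≡ n % q
∣∸⇒%≡ {m} {n} {q} m≤n q∣n∸m = begin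
  m % q              ≡⟨ %-remove-+ʳ m q∣n∸m ⟨
  (m + (n ∸ m)) % q  ≡⟨ cong (_% q) (m+[n∸m]≡n m≤n) ⟩
  n % q              ∎

%≡⇒∣∣-∣ : ∀ {m n q} .{{_ : NonZero q}} → m % q ≡ n % q → q ∣ ∣ m - n ∣
%≡⇒∣∣-∣ {m} {n} {q} eq with ≤-total m n
... | inj₁ m≤n = subst (q ∣_) (sym (m≤n⇒∣m-n∣≡n∸m m≤n)) (%≡⇒∣∸ eq)
... | inj₂ n≤m = subst (q ∣_) (sym (m≤n⇒∣n-m∣≡n∸m n≤m)) (%≡⇒∣∸ (sym eq))

∣∣-∣⇒%≡ : ∀ {m n q} .{{_ : NonZero q}} → q ∣ ∣ m - n ∣ → m % q ≡ n % q
∣∣-∣⇒%≡ {m} {n} {q} q∣ with ≤-total m n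
... | inj₁ m≤n = ∣∸⇒%≡ m≤n (subst (q ∣_) (m≤n⇒∣m-n∣≡n∸m m≤n) q∣)
... | inj₂ n≤m = sym (∣∸⇒%≡ n≤m (subst (q ∣_) (m≤n⇒∣n-m∣≡n∸m n≤m) q∣))

coprime-1 : ∀ {n} → Coprime 1 n
coprime-1 (i∣1 , _) = ∣1⇒≡1 i∣1

coprime-∣ : ∀ {m n o} → m ∣ n → Coprime n o → Coprime m o
coprime-∣ m∣n c (i∣m , i∣o) = c (∣-trans i∣m m∣n , i∣o)

coprime-* : ∀ {m n o} → Coprime m o → Coprime n o → Coprime (m * n) o
coprime-* {m} c₁ c₂ {i} (i∣mn , i∣o) = c₂ (coprime-divisor i⊥m i∣mn , i∣o)
  where
  i⊥m : Coprime i m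
  i⊥m (j∣i , j∣m) = c₁ (j∣m , ∣-trans j∣i i∣o)

coprime-^ : ∀ {m n} k → Coprime m n → Coprime (m ^ k) n
coprime-^ zero    c = coprime-1
coprime-^ (suc k) c = coprime-* c (coprime-^ k c)

coprime⇒*∣ : ∀ {m n o} → Coprime m n → m ∣ o → n ∣ o → m * n ∣ o
coprime⇒*∣ {m} {n} c (divides k refl) n∣km =
  subst (m * n ∣_) (*-comm m k)
    (*-monoʳ-∣ m (coprime-divisor (coprime-sym c) (subst (n ∣_) (*-comm k m) n∣km)))

gcd-*-coprime : ∀ m n o → Coprime m o → gcd m (n * o) ≡ gcd m n
gcd-*-coprime m n o m⊥o = ∣-antisym
  (gcd-greatest (gcd[m,n]∣m m (n * o))
    (coprime-divisor (coprime-∣ (gcd[m,n]∣m m (n * o)) m⊥o)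
      (subst (gcd m (n * o) ∣_) (*-comm n o) (gcd[m,n]∣n m (n * o)))))
  (gcd-greatest (gcd[m,n]∣m m n) (∣-trans (gcd[m,n]∣n m n) (m∣m*n o)))

coprime⇒inverse : ∀ {m q} .{{_ : NonZero q}} → Coprime m q → ∃[ x ] (x * m) % q ≡ 1 % q
coprime⇒inverse {m} {suc k} c with coprime-Bézout c
... | Bézout.+- x y eq = x , (begin
  (x * m) % suc k          ≡⟨ cong (_% suc k) eq ⟨
  (1 + y * suc k) % suc k  ≡⟨ [m+kn]%n≡m%n 1 y (suc k) ⟩
  1 % suc k                ∎)
-- Here x·m ≡ -1 (mod k+1), so k·x·m ≡ 1.
... | Bézout.-+ x y eq = k * x , (begin
  (k * x * m) % suc k                ≡⟨ [m+n]%n≡m%n (k * x * m) (suc k) ⟨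
  (k * x * m + suc k) % suc k        ≡⟨ cong (_% suc k) (regroup k x m) ⟩
  (1 + k * (1 + x * m)) % suc k      ≡⟨ cong (λ z → (1 + k * z) % suc k) eq ⟩
  (1 + k * (y * suc k)) % suc k      ≡⟨ cong (λ z → (1 + z) % suc k) (*-assoc k y (suc k)) ⟨
  (1 + k * y * suc k) % suc k        ≡⟨ [m+kn]%n≡m%n 1 (k * y) (suc k) ⟩
  1 % suc k                          ∎)
  where
  regroup : ∀ k x m → k * x * m + suc k ≡ 1 + k * (1 + x * m)
  regroup = solve-∀

coprime⇒shift : ∀ {m q} .{{_ : NonZero q}} → Coprime m q → ∀ n a → ∃[ t ] (n + t * m) % q ≡ a % q
coprime⇒shift {m} {suc k} c n a with coprime⇒inverse c
... | x , xm≡1 = c′ * x , (begin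
  (n + c′ * x * m) % suc k    ≡⟨ cong (λ z → (n + z) % suc k) (*-assoc c′ x m) ⟩
  (n + c′ * (x * m)) % suc k  ≡⟨ %-+-cong {n} {n} refl (%-*-cong {c′} {c′} refl xm≡1) ⟩
  (n + c′ * 1) % suc k        ≡⟨ cong (_% suc k) (regroup n k a) ⟩
  (a + n * suc k) % suc k     ≡⟨ [m+kn]%n≡m%n a n (suc k) ⟩
  a % suc k                   ∎)
  where
  c′ = k * n + a
  regroup : ∀ n k a → n + (k * n + a) * 1 ≡ a + n * suc k
  regroup = solve-∀

∣prodF : ∀ s (d : Fin s → ℕ) j → d j ∣ prodF s d
∣prodF (suc s) d Fin.zero    = m∣m*n (prodF s (d ∘ Fin.suc))
∣prodF (suc s) d (Fin.suc j) = ∣n⇒∣m*n (d Fin.zero) (∣prodF s (d ∘ Fin.suc) j)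

prodF-nonZero : ∀ s (d : Fin s → ℕ) → (∀ j → NonZero (d j)) → NonZero (prodF s d)
prodF-nonZero zero    d nz = _
prodF-nonZero (suc s) d nz =
  m*n≢0 _ _ {{nz Fin.zero}} {{prodF-nonZero s (d ∘ Fin.suc) (nz ∘ Fin.suc)}}

prodF-coprime : ∀ s (d : Fin s → ℕ) {n} → (∀ j → Coprime (d j) n) → Coprime (prodF s d) n
prodF-coprime zero    d c = coprime-1
prodF-coprime (suc s) d c = coprime-* (c Fin.zero) (prodF-coprime s (d ∘ Fin.suc) (c ∘ Fin.suc))

lcmF∣prodF : ∀ s (d : Fin s → ℕ) → lcmF s d ∣ prodF s d
lcmF∣prodF zero    d = ∣-refl
lcmF∣prodF (suc s) d =
  lcm-least {d Fin.zero} (m∣m*n (prodF s (d ∘ Fin.suc))) (∣n⇒∣m*n (d Fin.zero) (lcmF∣prodF s (d ∘ Fin.suc)))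

Solvable : (s : ℕ) → (α d : Fin s → ℕ) → ℕ → ℕ → Set
Solvable s α d a q = ∃ (Solves s α d a q)

Solves-%-invariant : ∀ {s α d a q M n n′} .{{_ : NonZero q}} .{{_ : NonZero M}} →
                     (∀ j → NonZero (d j)) → (∀ j → d j ∣ M) → q ∣ M →
                     n % M ≡ n′ % M → Solves s α d a q n → Solves s α d a q n′
Solves-%-invariant {α = α} {d = d} {n = n} {n′ = n′} nz d∣M q∣M n≡n′ (d∣ , q∣) =
  d∣′ , %≡⇒∣∣-∣ (trans (sym (%≡-∣ q∣M n≡n′)) (∣∣-∣⇒%≡ q∣))
  where
  d∣′ : ∀ j → d j ∣ n′ + α j
  d∣′ j = m%n≡0⇒n∣m (n′ + α j) (d j) (begin
    (n′ + α j) % d j  ≡⟨ %-+-cong {n} {n′} {α j} {α j} {d j} (%≡-∣ (d∣M j) n≡n′) refl ⟨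
    (n + α j) % d j   ≡⟨ n∣m⇒m%n≡0 (n + α j) (d j) (d∣ j) ⟩
    0                 ∎)
    where instance _ = nz j

Solvable⇒boundedSolution : ∀ {s α d a q} .{{_ : NonZero q}} → (∀ j → NonZero (d j)) →
                           Solvable s α d a q →
                           ∃ λ (i : Fin (q * prodF s d)) → Solves s α d a q (toℕ i)
Solvable⇒boundedSolution {s} {α} {d} {a} {q} nz (n , sol) =
  fromℕ< (m%n<n n M) ,
  subst (Solves s α d a q) (sym (toℕ-fromℕ< _))
    (Solves-%-invariant nz (λ j → ∣-trans (∣prodF s d j) (n∣m*n q)) (m∣m*n _) (sym (m%n%n≡m%n n M)) sol)
  where
  M = q * prodF s d
  instance
    _ = prodF-nonZero s d nz
    M≢0 : NonZero M
    M≢0 = m*n≢0 q (prodF s d)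

solvable? : ∀ {s α d a q} .{{_ : NonZero q}} → (∀ j → NonZero (d j)) → Dec (Solvable s α d a q)
solvable? {s} {α} {d} {a} {q} nz =
  map′ (λ (i , sol) → toℕ i , sol) (Solvable⇒boundedSolution nz)
    (any? (λ (i : Fin (q * prodF s d)) → solves? s α d a q (toℕ i)))

𝓔-solvable : ∀ {s α d a q} .{{_ : NonZero q}} → (∀ j → NonZero (d j)) →
             Solvable s α d a q → 𝓔 s α a d q ≡ 1ℚ
𝓔-solvable {s} {α} {d} {a} {q} nz sol
  with any? (λ (i : Fin (q * prodF s d)) → solves? s α d a q (toℕ i))
... | yes _    = refl
... | no none = ⊥-elim (none (Solvable⇒boundedSolution nz sol))

𝓔-unsolvable : ∀ {s α d a q} → ¬ Solvable s α d a q → 𝓔 s α a d q ≡ 0ℚ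
𝓔-unsolvable {s} {α} {d} {a} {q} ¬sol
  with any? (λ (i : Fin (q * prodF s d)) → solves? s α d a q (toℕ i))
... | yes (i , sol) = ⊥-elim (¬sol (toℕ i , sol))
... | no _          = refl

𝓔-cong : ∀ {s α d a b q q′} .{{_ : NonZero q}} .{{_ : NonZero q′}} → (∀ j → NonZero (d j)) →
         Solvable s α d a q ⇔ Solvable s α d b q′ → 𝓔 s α a d q ≡ 𝓔 s α b d q′
𝓔-cong {a = a} {q = q} nz a⇔b with solvable? {a = a} {q = q} nz
... | yes sol = trans (𝓔-solvable nz sol) (sym (𝓔-solvable nz (Equivalence.to a⇔b sol)))
... | no ¬sol = trans (𝓔-unsolvable ¬sol) (sym (𝓔-unsolvable (¬sol ∘ Equivalence.from a⇔b)))

Solvable-crt : ∀ {s α d a b q₁ q₂} .{{_ : NonZero q₁}} .{{_ : NonZero q₂}} →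
               (∀ j → NonZero (d j)) → (∀ j → Coprime (d j) q₂) → Coprime q₁ q₂ →
               a % q₁ ≡ b % q₁ → Solvable s α d a (q₁ * q₂) ⇔ Solvable s α d b q₁
Solvable-crt {s} {α} {d} {a} {b} {q₁} {q₂} nz d⊥q₂ q₁⊥q₂ a≡b = mk⇔ project lift
  where
  project : Solvable s α d a (q₁ * q₂) → Solvable s α d b q₁
  project (n , d∣ , q∣) = n , d∣ , %≡⇒∣∣-∣ (trans (∣∣-∣⇒%≡ {n} (∣-trans (m∣m*n q₂) q∣)) a≡b)

  M = q₁ * prodF s d
  instance
    _ = prodF-nonZero s d nz
    M≢0 : NonZero M
    M≢0 = m*n≢0 q₁ (prodF s d)

  -- Shift a solution by a multiple of M, which preserves it, to fix its residue mod q₂.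
  lift : Solvable s α d b q₁ → Solvable s α d a (q₁ * q₂)
  lift (n , sol) with coprime⇒shift (coprime-* q₁⊥q₂ (prodF-coprime s d d⊥q₂)) n a
  ... | t , n′≡a[q₂] = n′ , proj₁ sol′ , coprime⇒*∣ q₁⊥q₂ q₁∣ (%≡⇒∣∣-∣ n′≡a[q₂])
    where
    n′ = n + t * M
    sol′ : Solves s α d b q₁ n′
    sol′ = Solves-%-invariant nz (λ j → ∣-trans (∣prodF s d j) (n∣m*n q₁)) (m∣m*n (prodF s d))
             (sym ([m+kn]%n≡m%n n t M)) sol
    q₁∣ : q₁ ∣ ∣ n′ - a ∣
    q₁∣ = %≡⇒∣∣-∣ (trans (∣∣-∣⇒%≡ {n′} (proj₂ sol′)) (sym a≡b))

sumδ-cong : ∀ s {F G : (Fin s → Bool) → ℚ} → (∀ δ → F δ ≡ G δ) → sumδ s F ≡ sumδ s G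
sumδ-cong zero    F≡G = F≡G _
sumδ-cong (suc s) F≡G = cong₂ _+ℚ_ (sumδ-cong s (λ _ → F≡G _)) (sumδ-cong s (λ _ → F≡G _))

χ-term-crt : ∀ {s α d a b q₁ q₂} .{{_ : NonZero q₁}} .{{_ : NonZero q₂}} →
             (∀ j → NonZero (d j)) → (∀ j → Coprime (d j) q₂) → Coprime q₁ q₂ → a % q₁ ≡ b % q₁ →
             frac (gcd (lcmF s d) (q₁ * q₂)) (lcmF s d) *ℚ 𝓔 s α a d (q₁ * q₂)
             ≡ frac (gcd (lcmF s d) q₁) (lcmF s d) *ℚ 𝓔 s α b d q₁
χ-term-crt {s} {d = d} {q₁ = q₁} {q₂} nz d⊥q₂ q₁⊥q₂ a≡b =
  cong₂ (λ g e → frac g (lcmF s d) *ℚ e)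
    (gcd-*-coprime (lcmF s d) q₁ q₂ (coprime-∣ (lcmF∣prodF s d) (prodF-coprime s d d⊥q₂)))
    (𝓔-cong nz (Solvable-crt nz d⊥q₂ q₁⊥q₂ a≡b))
  where instance _ = m*n≢0 q₁ q₂

χ-crt : ∀ s α r {a b p q₁ q₂} .{{_ : NonZero p}} .{{_ : NonZero q₁}} .{{_ : NonZero q₂}} →
        p ∣ q₁ → Coprime q₁ q₂ → a % q₁ ≡ b % q₁ → χ s α r a (q₁ * q₂) p ≡ χ s α r b q₁ p
χ-crt s α r {p = p} {q₂ = q₂} p∣q₁ q₁⊥q₂ a≡b = sumδ-cong s λ δ →
  cong (signδ s δ *ℚ_)
    (χ-term-crt {d = λ j → if δ j then p ^ r j else 1}
      (λ j → power-nonZero (δ j) (r j)) (λ j → power-coprime (δ j) (r j)) q₁⊥q₂ a≡b)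
  where
  power-nonZero : ∀ b k → NonZero (if b then p ^ k else 1)
  power-nonZero true  k = m^n≢0 p k
  power-nonZero false _ = _
  power-coprime : ∀ b k → Coprime (if b then p ^ k else 1) q₂
  power-coprime true  k = coprime-^ k (coprime-∣ p∣q₁ q₁⊥q₂)
  power-coprime false _ = coprime-1

∏ : (ℕ → ℚ) → List ℕ → ℚ
∏ f = foldr (λ p acc → f p *ℚ acc) 1ℚ

∏-cong : ∀ {f g} xs → (∀ p → f p ≡ g p) → ∏ f xs ≡ ∏ g xs
∏-cong []       f≡g = refl
∏-cong (x ∷ xs) f≡g = cong₂ _*ℚ_ (f≡g x) (∏-cong xs f≡g)

∏-* : ∀ f g xs → ∏ (λ p → f p *ℚ g p) xs ≡ ∏ f xs *ℚ ∏ g xs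
∏-* f g []       = refl
∏-* f g (x ∷ xs) = trans (cong (f x *ℚ g x *ℚ_) (∏-* f g xs)) (interchange (f x) (g x) (∏ f xs) (∏ g xs))

restrictTo : {P : Pred ℕ 0ℓ} → Decidable P → (ℕ → ℚ) → ℕ → ℚ
restrictTo P? f p = if does (P? p) then f p else 1ℚ

∏-filter : ∀ {P : Pred ℕ 0ℓ} (P? : Decidable P) f xs → ∏ f (filter P? xs) ≡ ∏ (restrictTo P? f) xs
∏-filter P? f []       = refl
∏-filter P? f (x ∷ xs) with does (P? x)
... | true  = cong (f x *ℚ_) (∏-filter P? f xs)
... | false = trans (∏-filter P? f xs) (sym (ℚ.*-identityˡ _))

filter-upTo-beyond : ∀ {P : Pred ℕ 0ℓ} (P? : Decidable P) {N} → (∀ p → N ≤ p → ¬ P p) →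
                     ∀ M → N ≤ M → filter P? (upTo M) ≡ filter P? (upTo N)
filter-upTo-beyond P? {N} ¬P M N≤M with m≤n⇒m<n∨m≡n N≤M
... | inj₂ refl = refl
... | inj₁ (s≤s {n = m} N≤m) = begin
  filter P? (upTo (suc m))               ≡⟨ cong (filter P?) (upTo-∷ʳ m) ⟨
  filter P? (upTo m ++ [ m ])            ≡⟨ filter-++ P? (upTo m) [ m ] ⟩
  filter P? (upTo m) ++ filter P? [ m ]  ≡⟨ cong (filter P? (upTo m) ++_) (filter-reject P? (¬P m N≤m)) ⟩
  filter P? (upTo m) ++ []               ≡⟨ ++-identityʳ _ ⟩
  filter P? (upTo m)                     ≡⟨ filter-upTo-beyond P? ¬P m N≤m ⟩
  filter P? (upTo N)                     ∎

PrimeDivisor : ℕ → Pred ℕ 0ℓ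
PrimeDivisor q p = Prime p × p ∣ q

primeDivisor? : ∀ q → Decidable (PrimeDivisor q)
primeDivisor? q p = prime? p ×-dec p ∣? q

∏-primeDivisors : ∀ f q .{{_ : NonZero q}} N → q < N →
                  ∏ f (primeDivisors q) ≡ ∏ (restrictTo (primeDivisor? q) f) (upTo N)
∏-primeDivisors f q N q<N = begin
  ∏ f (filter (primeDivisor? q) (upTo (suc q)))  ≡⟨ cong (∏ f) (filter-upTo-beyond (primeDivisor? q) beyond N q<N) ⟨
  ∏ f (filter (primeDivisor? q) (upTo N))        ≡⟨ ∏-filter (primeDivisor? q) f (upTo N) ⟩
  ∏ (restrictTo (primeDivisor? q) f) (upTo N)    ∎
  where
  beyond : ∀ p → q < p → ¬ PrimeDivisor q p
  beyond p q<p (_ , p∣q) = <⇒≱ q<p (∣⇒≤ p∣q)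

restrictTo-primeDivisor-* :
  ∀ {q₁ q₂} → Coprime q₁ q₂ → (F f₁ f₂ : ℕ → ℚ) →
  (∀ p → Prime p → p ∣ q₁ → F p ≡ f₁ p) → (∀ p → Prime p → p ∣ q₂ → F p ≡ f₂ p) →
  ∀ p → restrictTo (primeDivisor? (q₁ * q₂)) F p
        ≡ restrictTo (primeDivisor? q₁) f₁ p *ℚ restrictTo (primeDivisor? q₂) f₂ p
restrictTo-primeDivisor-* {q₁} {q₂} q₁⊥q₂ F f₁ f₂ F≡f₁ F≡f₂ p
  with prime? p | p ∣? q₁ | p ∣? q₂ | p ∣? q₁ * q₂
... | no _   | _      | _      | _      = refl
... | yes pr | yes d₁ | yes d₂ | _      = ⊥-elim (¬prime[1] (subst Prime (q₁⊥q₂ (d₁ , d₂)) pr))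
... | yes pr | yes d₁ | no _   | yes _  = trans (F≡f₁ p pr d₁) (sym (ℚ.*-identityʳ _))
... | yes pr | no _   | yes d₂ | yes _  = trans (F≡f₂ p pr d₂) (sym (ℚ.*-identityˡ _))
... | yes _  | yes d₁ | no _   | no ∤q  = ⊥-elim (∤q (∣-trans d₁ (m∣m*n q₂)))
... | yes _  | no _   | yes d₂ | no ∤q  = ⊥-elim (∤q (∣-trans d₂ (n∣m*n q₁)))
... | yes pr | no ∤q₁ | no ∤q₂ | yes d  = ⊥-elim ([ ∤q₁ , ∤q₂ ]′ (euclidsLemma q₁ q₂ pr d))
... | yes _  | no _   | no _   | no _   = refl

mainTheorem12 : (s : ℕ) → 1 ≤ s → (α r : Fin s → ℕ)
    → (∀ i → 2 ≤ r i) → (∀ i j → toℕ i ≤ toℕ j → r i ≤ r j)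
    → (q₁ q₂ a₁ a₂ : ℕ) → 1 ≤ q₁ → 1 ≤ q₂ → 1 ≤ a₁ → 1 ≤ a₂
    → gcd q₁ q₂ ≡ 1
    → h s α r (q₁ * q₂) (a₁ * q₂ + a₂ * q₁)
    ≡ h s α r q₁ (a₁ * q₂) *ℚ h s α r q₂ (a₂ * q₁)
mainTheorem12 s _ α r _ _ q₁ q₂ a₁ a₂ (s≤s z≤n) (s≤s z≤n) _ _ gcd≡1 = begin
  ∏ χ₁₂ (primeDivisors (q₁ * q₂))
    ≡⟨ ∏-primeDivisors χ₁₂ (q₁ * q₂) N ≤-refl ⟩
  ∏ (restrictTo (primeDivisor? (q₁ * q₂)) χ₁₂) (upTo N)
    ≡⟨ ∏-cong (upTo N) (restrictTo-primeDivisor-* q₁⊥q₂ χ₁₂ χ₁ χ₂ χ₁₂≡χ₁ χ₁₂≡χ₂) ⟩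
  ∏ (λ p → restrictTo (primeDivisor? q₁) χ₁ p *ℚ restrictTo (primeDivisor? q₂) χ₂ p) (upTo N)
    ≡⟨ ∏-* (restrictTo (primeDivisor? q₁) χ₁) (restrictTo (primeDivisor? q₂) χ₂) (upTo N) ⟩
  ∏ (restrictTo (primeDivisor? q₁) χ₁) (upTo N) *ℚ ∏ (restrictTo (primeDivisor? q₂) χ₂) (upTo N)
    ≡⟨ cong₂ _*ℚ_ (∏-primeDivisors χ₁ q₁ N (s≤s (m≤m*n q₁ q₂))) (∏-primeDivisors χ₂ q₂ N (s≤s (m≤n*m q₂ q₁))) ⟨
  ∏ χ₁ (primeDivisors q₁) *ℚ ∏ χ₂ (primeDivisors q₂)
    ∎
  where
  N = suc (q₁ * q₂)
  χ₁₂ χ₁ χ₂ : ℕ → ℚ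
  χ₁₂ = χ s α r (a₁ * q₂ + a₂ * q₁) (q₁ * q₂)
  χ₁  = χ s α r (a₁ * q₂) q₁
  χ₂  = χ s α r (a₂ * q₁) q₂
  q₁⊥q₂ : Coprime q₁ q₂
  q₁⊥q₂ = gcd≡1⇒coprime gcd≡1
  χ₁₂≡χ₁ : ∀ p → Prime p → p ∣ q₁ → χ₁₂ p ≡ χ₁ p
  χ₁₂≡χ₁ p pr p∣q₁ =
    χ-crt s α r {{prime⇒nonZero pr}} p∣q₁ q₁⊥q₂ (%-remove-+ʳ (a₁ * q₂) (n∣m*n a₂))
  χ₁₂≡χ₂ : ∀ p → Prime p → p ∣ q₂ → χ₁₂ p ≡ χ₂ p
  χ₁₂≡χ₂ p pr p∣q₂ = trans (cong (λ q → χ s α r (a₁ * q₂ + a₂ * q₁) q p) (*-comm q₁ q₂))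
    (χ-crt s α r {{prime⇒nonZero pr}} p∣q₂ (coprime-sym q₁⊥q₂) (%-remove-+ˡ (a₂ * q₁) (n∣m*n a₁)))
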